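{- Let $\alpha \geq 1$ be an integer, let $v$ be an interval of integers and let $Q$ be a set of $k \geq 1$ intervals of integers. Then there is a set $R$ of at most $k+1$ intervals of integers such that $v^{[\alpha]} \cap \left(\bigcup_{w\in Q} w\right)^{[\alpha]} = \left(\bigcup_{w \in R} w\right)^{[\alpha]}$.
   Context: For an integer $\alpha\ge 1$ and a set $X\subseteq\mathbb{Z}$, $X^{[\alpha]} = \{z \bmod \alpha : z \in X\}\subseteq[0,\alpha)$. Intervals are sets of the form $\{z\in\mathbb{Z}:\ell\le z\le u\}$. -}

module Defs where

open import Data.Nat using (ℕ; NonZero)
open import Data.Integer using (ℤ; _≤_; _%ℕ_)
open import Data.Product using (_×_; Σ; ∃-syntax; _,_)
open import Data.List using (List)
open import Relation.Binary.PropositionalEquality using (_≡_)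
open import Data.List.Membership.Propositional using (_∈_)

SetZ : Set₁
SetZ = ℤ → Set

SetN : Set₁
SetN = ℕ → Set

-- An interval {z ∈ ℤ : ℓ ≤ z ≤ u}, given by its bounds (ℓ , u);
-- if ℓ > u it is the empty interval.
Interval : Set
Interval = ℤ × ℤ

⟦_⟧ᴵ : Interval → SetZ
⟦ (ℓ , u) ⟧ᴵ z = (ℓ ≤ z) × (z ≤ u)

⋃ : List Interval → SetZ
⋃ Q z = Σ Interval λ w → (w ∈ Q) × ⟦ w ⟧ᴵ z

_^[_] : SetZ → (α : ℕ) → {{NonZero α}} → SetN
(X ^[ α ]) r = ∃[ z ] (X z × (z %ℕ α ≡ r))

-- Write v = [ℓ, u]. If v has at least α elements, v^[α] is all of [0, α) and R = Q works.
-- Otherwise translate each w = [a, b] in Q by a multiple of α so that a lands in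
-- [ℓ, ℓ + α); this does not change w^[α]. A point z of v congruent to some y of the
-- translated w then lies in w ∩ v if z ≥ a, and in [ℓ, b - α] if z < a (as then
-- z + α ≤ y). The first kind gives one interval per w; the second kind gives intervals
-- that all start at ℓ, whose union is a single interval: k + 1 intervals in total.
module Submission where

open import Defs
open import Data.Nat using (ℕ; NonZero; _≤_; suc)
open import Data.Product using (_×_; Σ)
open import Data.List using (List; length)
open import Relation.Binary.PropositionalEquality using (_≡_)
open import Function.Bundles using (_⇔_)

import Data.Nat as ℕ
import Data.Nat.Properties as ℕ
open import Data.Product using (_,_; proj₂)
open import Data.Sum using (_⊎_; inj₁; inj₂)
open import Data.Empty using (⊥-elim)
open import Data.List using (_∷_; map)
open import Data.List.Properties using (length-map)
open import Data.List.Relation.Unary.Any using (Any; here; there)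
import Data.List.Relation.Unary.Any as Any
open import Data.List.Relation.Unary.Any.Properties using (map⁻)
open import Data.List.Relation.Unary.All using (lookup)
open import Data.List.Membership.Propositional using (_∈_; find)
open import Data.List.Membership.Propositional.Properties using (∈-map⁺; ∈-map⁻)
open import Data.Integer using (ℤ; +_; _+_; _*_; -_; _-_; _⊓_; _%ℕ_; _/ℕ_; 1ℤ; pred; +<+)
  renaming (_≤_ to _≤ᶻ_; _<_ to _<ᶻ_; suc to sucℤ)
open import Data.Integer.Properties
open import Data.Integer.DivMod using (a≡a%ℕn+[a/ℕn]*n; n%ℕd<d)
open import Data.Integer.Tactic.RingSolver using (solve-∀)
open import Algebra.Properties.AbelianGroup +-0-abelianGroup
  using (∙-cancelʳ; //-rightDividesˡ; //-rightDividesʳ)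
open import Data.List.Extrema ≤-totalOrder using (max; xs≤max; argmax-sel)
open import Function.Base using (id)
open import Function.Bundles using (mk⇔)
open import Relation.Binary.PropositionalEquality using (refl; sym; trans; cong; subst; module ≡-Reasoning)
open import Relation.Binary.Definitions using (tri<; tri≈; tri>)
open import Relation.Nullary using (yes; no)

i+j≤k⇒i≤k-j : ∀ {i j k} → i + j ≤ᶻ k → i ≤ᶻ k - j
i+j≤k⇒i≤k-j {i} {j} {k} i+j≤k = subst (_≤ᶻ k - j) (//-rightDividesʳ j i) (+-monoˡ-≤ (- j) i+j≤k)

i≤j+k⇒i-k≤j : ∀ {i j k} → i ≤ᶻ j + k → i - k ≤ᶻ j
i≤j+k⇒i-k≤j {i} {j} {k} i≤j+k = subst (i - k ≤ᶻ_) (//-rightDividesʳ k j) (+-monoˡ-≤ (- k) i≤j+k)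

i≤j-k⇒i+k≤j : ∀ {i j k} → i ≤ᶻ j - k → i + k ≤ᶻ j
i≤j-k⇒i+k≤j {i} {j} {k} i≤j-k = subst (i + k ≤ᶻ_) (//-rightDividesˡ k j) (+-monoˡ-≤ k i≤j-k)

v≤max⁻ : ∀ {v} b xs → b <ᶻ v → v ≤ᶻ max b xs → Any (v ≤ᶻ_) xs
v≤max⁻ b xs b<v v≤max with argmax-sel id b xs
... | inj₁ max≡b = ⊥-elim (<-irrefl refl (<-≤-trans b<v (subst (_ ≤ᶻ_) max≡b v≤max)))
... | inj₂ max∈xs = Any.map (λ { refl → v≤max }) max∈xs

translate : ℤ → Interval → Interval
translate c (a , b) = (a + c , b + c)

∈-translate⁺ : ∀ c {a b z} → ⟦ a , b ⟧ᴵ z → ⟦ translate c (a , b) ⟧ᴵ (z + c)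
∈-translate⁺ c (a≤z , z≤b) = +-monoˡ-≤ c a≤z , +-monoˡ-≤ c z≤b

∈-translate⁻ : ∀ c {a b z} → ⟦ translate c (a , b) ⟧ᴵ z → ⟦ a , b ⟧ᴵ (z - c)
∈-translate⁻ c (a+c≤z , z≤b+c) = i+j≤k⇒i≤k-j a+c≤z , i≤j+k⇒i-k≤j z≤b+c

module _ (α : ℕ) {{_ : NonZero α}} where

  r+q*α<r′+q′*α : ∀ {r} r′ {q q′} → r ℕ.< α → q <ᶻ q′ → + r + q * + α <ᶻ + r′ + q′ * + α
  r+q*α<r′+q′*α {r} r′ {q} {q′} r<α q<q′ = begin-strict
    + r + q * + α    <⟨ +-monoˡ-< (q * + α) (+<+ r<α) ⟩
    + α + q * + α    ≡⟨ suc-* q (+ α) ⟨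
    sucℤ q * + α     ≤⟨ *-monoʳ-≤-nonNeg (+ α) (i<j⇒suc[i]≤j q<q′) ⟩
    q′ * + α         ≤⟨ i≤j⇒i≤k+j (+ r′) ≤-refl ⟩
    + r′ + q′ * + α  ∎
    where open ≤-Reasoning

  remainder-unique : ∀ {r r′} q q′ → r ℕ.< α → r′ ℕ.< α →
                     + r + q * + α ≡ + r′ + q′ * + α → r ≡ r′
  remainder-unique q q′ r<α r′<α eq with <-cmp q q′
  ... | tri< q<q′ _ _ = ⊥-elim (<-irrefl eq (r+q*α<r′+q′*α _ r<α q<q′))
  ... | tri> _ _ q>q′ = ⊥-elim (<-irrefl (sym eq) (r+q*α<r′+q′*α _ r′<α q>q′))
  ... | tri≈ _ refl _ = +-injective (∙-cancelʳ (q * + α) _ _ eq)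

  [r+q*α]%ℕα≡r : ∀ {r} q → r ℕ.< α → (+ r + q * + α) %ℕ α ≡ r
  [r+q*α]%ℕα≡r {r} q r<α =
    remainder-unique (x /ℕ α) q (n%ℕd<d x α) r<α (sym (a≡a%ℕn+[a/ℕn]*n x α))
    where x = + r + q * + α

  [x+j*α]%ℕα≡x%ℕα : ∀ x j → (x + j * + α) %ℕ α ≡ x %ℕ α
  [x+j*α]%ℕα≡x%ℕα x j = begin
    (x + j * + α) %ℕ α
      ≡⟨ cong (λ t → (t + j * + α) %ℕ α) (a≡a%ℕn+[a/ℕn]*n x α) ⟩
    (+ (x %ℕ α) + q * + α + j * + α) %ℕ α
      ≡⟨ cong (_%ℕ α) (regroup (+ (x %ℕ α)) q j (+ α)) ⟩
    (+ (x %ℕ α) + (q + j) * + α) %ℕ α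
      ≡⟨ [r+q*α]%ℕα≡r (q + j) (n%ℕd<d x α) ⟩
    x %ℕ α ∎
    where
    open ≡-Reasoning
    q = x /ℕ α
    regroup : ∀ r q j a → r + q * a + j * a ≡ r + (q + j) * a
    regroup = solve-∀

  [x-j*α]%ℕα≡x%ℕα : ∀ x j → (x - j * + α) %ℕ α ≡ x %ℕ α
  [x-j*α]%ℕα≡x%ℕα x j =
    trans (cong (λ t → (x + t) %ℕ α) (neg-distribˡ-* j (+ α))) ([x+j*α]%ℕα≡x%ℕα x (- j))

  [x+α]%ℕα≡x%ℕα : ∀ x → (x + + α) %ℕ α ≡ x %ℕ α
  [x+α]%ℕα≡x%ℕα x = subst (λ t → (x + t) %ℕ α ≡ x %ℕ α) (*-identityˡ (+ α)) ([x+j*α]%ℕα≡x%ℕα x 1ℤ)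

  congruent∧<⇒≤ : ∀ {x y} → x %ℕ α ≡ y %ℕ α → x <ᶻ y + + α → x ≤ᶻ y
  congruent∧<⇒≤ {x} {y} x≡y x<y+α with x /ℕ α ≤? y /ℕ α
  ... | yes qx≤qy = begin
    x                    ≡⟨ a≡a%ℕn+[a/ℕn]*n x α ⟩
    + r + x /ℕ α * + α   ≤⟨ +-monoʳ-≤ (+ r) (*-monoʳ-≤-nonNeg (+ α) qx≤qy) ⟩
    + r + y /ℕ α * + α   ≡⟨ cong (λ s → + s + y /ℕ α * + α) x≡y ⟩
    + (y %ℕ α) + y /ℕ α * + α  ≡⟨ a≡a%ℕn+[a/ℕn]*n y α ⟨
    y                    ∎
    where open ≤-Reasoning; r = x %ℕ α
  ... | no qx≰qy = ⊥-elim (<-irrefl refl (<-≤-trans x<y+α y+α≤x))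
    where
    r = y %ℕ α
    1+qy≤qx = i<j⇒suc[i]≤j (≰⇒> qx≰qy)
    regroup : ∀ r q a → r + q * a + a ≡ r + (1ℤ + q) * a
    regroup = solve-∀
    y+α≤x : y + + α ≤ᶻ x
    y+α≤x = begin
      y + + α                         ≡⟨ cong (_+ + α) (a≡a%ℕn+[a/ℕn]*n y α) ⟩
      + r + y /ℕ α * + α + + α        ≡⟨ regroup (+ r) (y /ℕ α) (+ α) ⟩
      + r + sucℤ (y /ℕ α) * + α       ≤⟨ +-monoʳ-≤ (+ r) (*-monoʳ-≤-nonNeg (+ α) 1+qy≤qx) ⟩
      + r + x /ℕ α * + α              ≡⟨ cong (λ s → + s + x /ℕ α * + α) x≡y ⟨
      + (x %ℕ α) + x /ℕ α * + α       ≡⟨ a≡a%ℕn+[a/ℕn]*n x α ⟨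
      x                               ∎
      where open ≤-Reasoning

  windowIndex : ℤ → ℤ → ℤ
  windowIndex ℓ x = - ((x - ℓ) /ℕ α)

  x+windowIndex*α≡ℓ+[x-ℓ]%ℕα : ∀ ℓ x → x + windowIndex ℓ x * + α ≡ ℓ + + ((x - ℓ) %ℕ α)
  x+windowIndex*α≡ℓ+[x-ℓ]%ℕα ℓ x = begin
    x + - q * + α                    ≡⟨ cong (_+ - q * + α) (//-rightDividesˡ ℓ x) ⟨
    x - ℓ + ℓ + - q * + α            ≡⟨ cong (λ d → d + ℓ + - q * + α) (a≡a%ℕn+[a/ℕn]*n (x - ℓ) α) ⟩
    + r + q * + α + ℓ + - q * + α    ≡⟨ cancel (+ r) q (+ α) ℓ ⟩
    ℓ + + r                          ∎
    where
    open ≡-Reasoning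
    q = (x - ℓ) /ℕ α
    r = (x - ℓ) %ℕ α
    cancel : ∀ r q a ℓ → r + q * a + ℓ + - q * a ≡ ℓ + r
    cancel = solve-∀

  ℓ≤x+windowIndex*α : ∀ ℓ x → ℓ ≤ᶻ x + windowIndex ℓ x * + α
  ℓ≤x+windowIndex*α ℓ x = subst (ℓ ≤ᶻ_) (sym (x+windowIndex*α≡ℓ+[x-ℓ]%ℕα ℓ x)) (i≤i+j ℓ _)

  x+windowIndex*α<ℓ+α : ∀ ℓ x → x + windowIndex ℓ x * + α <ᶻ ℓ + + α
  x+windowIndex*α<ℓ+α ℓ x = subst (_<ᶻ ℓ + + α) (sym (x+windowIndex*α≡ℓ+[x-ℓ]%ℕα ℓ x))
    (+-monoʳ-< ℓ (+<+ (n%ℕd<d (x - ℓ) α)))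

  congruent-split : ∀ {ℓ u a b z y} → u <ᶻ ℓ + + α → ℓ ≤ᶻ a →
                    ⟦ ℓ , u ⟧ᴵ z → ⟦ a , b ⟧ᴵ y → z %ℕ α ≡ y %ℕ α →
                    ⟦ a , b ⊓ u ⟧ᴵ z ⊎ ⟦ ℓ , (b - + α) ⊓ u ⟧ᴵ z
  congruent-split {a = a} {z = z} {y = y} u<ℓ+α ℓ≤a (ℓ≤z , z≤u) (a≤y , y≤b) z≡y
    with a ≤? z
  ... | yes a≤z = inj₁ (a≤z , ⊓-glb (≤-trans z≤y y≤b) z≤u)
    where
    z≤y : z ≤ᶻ y
    z≤y = congruent∧<⇒≤ z≡y (<-≤-trans (≤-<-trans z≤u u<ℓ+α) (+-monoˡ-≤ (+ α) (≤-trans ℓ≤a a≤y)))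
  ... | no a≰z = inj₂ (ℓ≤z , ⊓-glb (i+j≤k⇒i≤k-j (≤-trans z+α≤y y≤b)) z≤u)
    where
    z+α≤y : z + + α ≤ᶻ y
    z+α≤y = congruent∧<⇒≤ (trans ([x+α]%ℕα≡x%ℕα z) z≡y)
                           (+-monoˡ-< (+ α) (<-≤-trans (≰⇒> a≰z) a≤y))

  wrapped-∈ : ∀ {ℓ u a b z} → a <ᶻ ℓ + + α → ⟦ ℓ , (b - + α) ⊓ u ⟧ᴵ z → ⟦ a , b ⟧ᴵ (z + + α)
  wrapped-∈ {u = u} a<ℓ+α (ℓ≤z , z≤) =
    <⇒≤ (<-≤-trans a<ℓ+α (+-monoˡ-≤ (+ α) ℓ≤z)) , i≤j-k⇒i+k≤j (≤-trans z≤ (i⊓j≤i _ u))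

  module _ (ℓ u : ℤ) where

    shiftedPiece : Interval → Interval
    shiftedPiece (a , b) = (a + windowIndex ℓ a * + α , (b + windowIndex ℓ a * + α) ⊓ u)

    wrappedEnd : Interval → ℤ
    wrappedEnd (a , b) = (b + windowIndex ℓ a * + α - + α) ⊓ u

    -- The default pred ℓ of max keeps the wrapped interval empty when no wrapped piece is.
    pieces : List Interval → List Interval
    pieces Q = (ℓ , max (pred ℓ) (map wrappedEnd Q)) ∷ map shiftedPiece Q

    congruent-split-shifted : ∀ {a b z y} → u <ᶻ ℓ + + α →
                              ⟦ ℓ , u ⟧ᴵ z → ⟦ a , b ⟧ᴵ y → z %ℕ α ≡ y %ℕ α →
                              ⟦ shiftedPiece (a , b) ⟧ᴵ z ⊎ ⟦ ℓ , wrappedEnd (a , b) ⟧ᴵ z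
    congruent-split-shifted {a} {y = y} u<ℓ+α z∈v y∈w z≡y =
      congruent-split u<ℓ+α (ℓ≤x+windowIndex*α ℓ a) z∈v
        (∈-translate⁺ (windowIndex ℓ a * + α) y∈w)
        (trans z≡y (sym ([x+j*α]%ℕα≡x%ℕα y (windowIndex ℓ a))))

    ∈-shiftedPiece⁻ : ∀ {a b z} → ⟦ shiftedPiece (a , b) ⟧ᴵ z →
                      ⟦ ℓ , u ⟧ᴵ z × (⟦ a , b ⟧ᴵ ^[ α ]) (z %ℕ α)
    ∈-shiftedPiece⁻ {a} {z = z} (a′≤z , z≤) =
      (≤-trans (ℓ≤x+windowIndex*α ℓ a) a′≤z , ≤-trans z≤ (i⊓j≤j _ u)) ,
      ( z - s
      , ∈-translate⁻ s (a′≤z , ≤-trans z≤ (i⊓j≤i _ u))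
      , [x-j*α]%ℕα≡x%ℕα z (windowIndex ℓ a))
      where s = windowIndex ℓ a * + α

    ∈-wrappedPiece⁻ : ∀ {a b z} → ⟦ ℓ , wrappedEnd (a , b) ⟧ᴵ z →
                      ⟦ ℓ , u ⟧ᴵ z × (⟦ a , b ⟧ᴵ ^[ α ]) (z %ℕ α)
    ∈-wrappedPiece⁻ {a} {z = z} z∈wrapped@(ℓ≤z , z≤) =
      (ℓ≤z , ≤-trans z≤ (i⊓j≤j _ u)) ,
      ( z + + α - s
      , ∈-translate⁻ s (wrapped-∈ (x+windowIndex*α<ℓ+α ℓ a) z∈wrapped)
      , trans ([x-j*α]%ℕα≡x%ℕα (z + + α) (windowIndex ℓ a)) ([x+α]%ℕα≡x%ℕα z))
      where s = windowIndex ℓ a * + α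

    ∩-⋃-short-interval : u <ᶻ ℓ + + α → ∀ Q r →
                ((⟦ ℓ , u ⟧ᴵ ^[ α ]) r × (⋃ Q ^[ α ]) r) ⇔ (⋃ (pieces Q) ^[ α ]) r
    ∩-⋃-short-interval u<ℓ+α Q r = mk⇔ to from
      where
      to : (⟦ ℓ , u ⟧ᴵ ^[ α ]) r × (⋃ Q ^[ α ]) r → (⋃ (pieces Q) ^[ α ]) r
      to ((z , z∈v , z≡r) , (y , ((a , b) , w∈Q , y∈w) , y≡r))
        with congruent-split-shifted u<ℓ+α z∈v y∈w (trans z≡r (sym y≡r))
      ... | inj₁ z∈shifted = z , (_ , there (∈-map⁺ shiftedPiece w∈Q) , z∈shifted) , z≡r
      ... | inj₂ (ℓ≤z , z≤wrapped) =
        z , (_ , here refl , (ℓ≤z , ≤-trans z≤wrapped wrappedEnd≤max)) , z≡r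
        where wrappedEnd≤max = lookup (xs≤max _ _) (∈-map⁺ wrappedEnd w∈Q)

      from′ : ∀ {w z} → w ∈ Q → z %ℕ α ≡ r →
              ⟦ ℓ , u ⟧ᴵ z × (⟦ w ⟧ᴵ ^[ α ]) (z %ℕ α) → (⟦ ℓ , u ⟧ᴵ ^[ α ]) r × (⋃ Q ^[ α ]) r
      from′ {w} {z} w∈Q z≡r (z∈v , (y , y∈w , y≡z)) =
        (z , z∈v , z≡r) , (y , (w , w∈Q , y∈w) , trans y≡z z≡r)

      from : (⋃ (pieces Q) ^[ α ]) r → (⟦ ℓ , u ⟧ᴵ ^[ α ]) r × (⋃ Q ^[ α ]) r
      from (z , (_ , here refl , (ℓ≤z , z≤max)) , z≡r)
        with find (map⁻ (v≤max⁻ (pred ℓ) (map wrappedEnd Q) pred[ℓ]<z z≤max))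
        where pred[ℓ]<z = i≤pred[j]⇒i<j (pred-mono ℓ≤z)
      ... | (a , b) , w∈Q , z≤wrapped = from′ w∈Q z≡r (∈-wrappedPiece⁻ (ℓ≤z , z≤wrapped))
      from (z , (_ , there p∈ , z∈p) , z≡r) with ∈-map⁻ shiftedPiece p∈
      ... | (a , b) , w∈Q , refl = from′ w∈Q z≡r (∈-shiftedPiece⁻ z∈p)

  ∩-long-interval : ∀ {ℓ u} → ℓ + + α ≤ᶻ u → (X : SetZ) → ∀ r →
           ((⟦ ℓ , u ⟧ᴵ ^[ α ]) r × (X ^[ α ]) r) ⇔ (X ^[ α ]) r
  ∩-long-interval {ℓ} ℓ+α≤u X r = mk⇔ proj₂ λ X^r@(y , _ , y≡r) →
    ( y + windowIndex ℓ y * + α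
    , (ℓ≤x+windowIndex*α ℓ y , <⇒≤ (<-≤-trans (x+windowIndex*α<ℓ+α ℓ y) ℓ+α≤u))
    , trans ([x+j*α]%ℕα≡x%ℕα y (windowIndex ℓ y)) y≡r) , X^r

lemma5 : (α : ℕ) → {{_ : NonZero α}} → (v : Interval) → (k : ℕ) → 1 ≤ k →
    (Q : List Interval) → length Q ≡ k →
    Σ (List Interval) λ R → (length R ≤ suc k) ×
    ((r : ℕ) → ((⟦ v ⟧ᴵ ^[ α ]) r × (⋃ Q ^[ α ]) r) ⇔ (⋃ R ^[ α ]) r)
lemma5 α (ℓ , u) k _ Q |Q|≡k with u <? ℓ + + α
... | yes u<ℓ+α =
  pieces α ℓ u Q ,
  ℕ.s≤s (ℕ.≤-reflexive (trans (length-map _ Q) |Q|≡k)) ,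
  ∩-⋃-short-interval α ℓ u u<ℓ+α Q
... | no u≮ℓ+α =
  Q ,
  ℕ.m≤n⇒m≤1+n (ℕ.≤-reflexive |Q|≡k) ,
  ∩-long-interval α (≮⇒≥ u≮ℓ+α) (⋃ Q)
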